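{- For every positive integer $n$, there is an explicit bijection between $\mathcal{L}_n$ and $\mathcal{D}_{n-1}$. In particular, $|\mathcal{L}_n| = \mathrm{Cat}_{n-1} = \frac{1}{n}\binom{2n-2}{n-1}$.
   Context: For a positive integer $n$, $\mathcal{L}_n$ denotes the set of all words $a=(a_1,\ldots,a_n)$ of $n$ nonnegative integers such that (1) $a_{i+1}\geq a_i-1$ for all $1\le i<n$, and (2) whenever $a_i=k>0$ with $i$ minimal among the positions where $k$ occurs (i.e. the leftmost occurrence of $k$), there exist indices $i_1<i<i_2$ with $a_{i_1}=a_{i_2}=k-1$. A Dyck path of length $2m$ is a sequence of $m$ north steps $N$ and $m$ east steps $E$ such that every prefix contains no more east steps than north steps (equivalently a lattice path from $(0,0)$ to $(m,m)$ never going below the diagonal); $\mathcal{D}_m$ denotes the set of Dyck paths of length $2m$ ($\mathcal{D}_0$ consists of the empty path). -}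

module Defs where

open import Data.Bool using (Bool; true; false; _∧_; T; if_then_else_)
open import Data.Nat using (ℕ; zero; suc; _*_; _/_; _≤ᵇ_; _≡ᵇ_; pred)
open import Data.Nat.Combinatorics using (_C_)
open import Data.List using (List; []; _∷_; _++_; [_])
open import Data.Bool.ListAction using (any)
open import Data.Vec using (Vec; toList)
open import Data.Product using (Σ)

-- Condition (1): a_{i+1} ≥ a_i - 1, i.e. a_i ≤ a_{i+1} + 1, for consecutive entries.
cond1 : List ℕ → Bool
cond1 (x ∷ y ∷ r) = (x ≤ᵇ suc y) ∧ cond1 (y ∷ r)
cond1 _ = true

_∈ᵇ_ : ℕ → List ℕ → Bool
k ∈ᵇ xs = any (λ y → y ≡ᵇ k) xs

-- Condition (2): scanning left to right with the prefix 'pre' already read.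
-- At an entry x = k > 0 which is a leftmost occurrence (k not in the prefix),
-- k-1 must occur strictly to the left (in pre) and strictly to the right (in rest).
cond2 : List ℕ → List ℕ → Bool
cond2 pre [] = true
cond2 pre (zero ∷ rest) = cond2 (pre ++ [ zero ]) rest
cond2 pre (suc k ∷ rest) =
  (if suc k ∈ᵇ pre then true else ((k ∈ᵇ pre) ∧ (k ∈ᵇ rest)))
  ∧ cond2 (pre ++ [ suc k ]) rest

isL : List ℕ → Bool
isL a = cond1 a ∧ cond2 [] a

L : ℕ → Set
L n = Σ (Vec ℕ n) (λ a → T (isL (toList a)))

data Step : Set where
  N E : Step

-- dyckFrom h w: starting at height h (#N - #E so far), every prefix keeps
-- height ≥ 0 and the path ends at height 0.
dyckFrom : ℕ → List Step → Bool
dyckFrom h [] = h ≡ᵇ 0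
dyckFrom h (N ∷ w) = dyckFrom (suc h) w
dyckFrom zero (E ∷ w) = false
dyckFrom (suc h) (E ∷ w) = dyckFrom h w

D : ℕ → Set
D m = Σ (Vec Step (2 * m)) (λ w → T (dyckFrom 0 (toList w)))

catalan : ℕ → ℕ
catalan m = ((2 * m) C m) / suc m

module Submission where

-- Both families are generating trees with the succession rule
-- (k) ⇝ (2)(3)⋯(k+1): every object of size n+1 arises from a unique parent of
-- size n and an index j < label(parent), and then has label j + 2.  For a Dyck
-- path the label is 1 + the length of its initial run of north steps and a
-- child adds a peak inside that run.  For a word a with maximum M the label is
-- the number of Ms plus the number of (M-1)s after the last M, and a child
-- inserts M + 1 before a non-first M, or M before one of those (M-1)s or at
-- the end; the parent deletes the last M.  Two generating trees with
-- isomorphic roots are isomorphic at every size (treeIso).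
--
-- For the count, Pascal's rule gives paths with k of n steps north ↔ Fin (n C k),
-- and the reflection principle identifies the non-Dyck paths among those with
-- m+1 of 2m+2 steps north with the paths having m north steps; cancelling the
-- latter (cancel-Fin) leaves Fin (C(2m+2, m+1) - C(2m+2, m)) = Fin Cat_{m+1}.

open import Defs
open import Data.Nat using (ℕ; _≤_; _∸_)
open import Data.Fin using (Fin)
open import Data.Product using (_×_)
open import Function.Bundles using (_⤖_)

open import Data.Bool using (Bool; true; false; T; not; _∧_; _∨_; if_then_else_)
open import Data.Bool.Properties using (T-irrelevant; T-∧; T-≡; ∧-identityʳ; ∧-zeroʳ; ∨-assoc; ∨-identityʳ; ∨-zeroʳ)
open import Data.Empty using (⊥; ⊥-elim; ⊥-elim-irr)
open import Data.Fin using (toℕ; fromℕ<)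
import Data.Fin as Fin
open import Data.Fin.Properties using (toℕ-injective; toℕ-fromℕ<; toℕ<n; +↔⊎; 1↔⊤)
open import Data.List using (List; []; _∷_; _++_; length; drop; [_])
open import Data.List.Properties using (++-assoc; ++-identityʳ; length-++-sucʳ)
open import Data.List.Relation.Unary.All using (All; []; _∷_)
import Data.List.Relation.Unary.All as All
open import Data.List.Relation.Unary.All.Properties using (++⁺; ++⁻ˡ; ++⁻ʳ)
open import Data.Nat using (zero; suc; _+_; _*_; _/_; _<_; z≤n; s≤s; pred; _⊔_; _≡ᵇ_; _≤ᵇ_; _<ᵇ_)
open import Data.Nat.Properties
open import Data.Nat.Combinatorics using (_C_; nCk+nC[k+1]≡[n+1]C[k+1]; nC1≡n)
open import Data.Nat.DivMod using (m*n/n≡m)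
open import Data.Nat.Tactic.RingSolver using (solve-∀)
open import Data.Product using (Σ; _,_; proj₁; proj₂)
open import Data.Product.Function.Dependent.Propositional using (Σ-↔)
open import Data.Sum using (_⊎_; inj₁; inj₂)
open import Data.Sum.Algebra using (⊎-cong; ⊎-assoc; ⊎-comm)
open import Data.Unit using (⊤; tt)
open import Data.Vec using (Vec; toList; fromList)
open import Data.Vec.Properties using (toList∘fromList; toList-injective; length-toList)
open import Data.Vec.Relation.Binary.Equality.Cast using (cast-is-id)
open import Function.Bundles using (_↔_; Inverse; Equivalence; mk↔ₛ′)
open import Function.Properties.Inverse using (↔-refl; ↔-sym; ↔-trans; ↔⇒⤖)
open import Function.Related.Propositional using (module EquationalReasoning)
open import Level using (0ℓ)
open import Relation.Binary.PropositionalEquality hiding ([_])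
open import Relation.Nullary using (¬_; yes; no)
open Inverse using (to; from; strictlyInverseʳ; inverseʳ)

Fin-cong : ∀ {a b} → a ≡ b → Fin a ↔ Fin b
Fin-cong refl = ↔-refl

toℕ-Fin-cong : ∀ {a b} (e : a ≡ b) (i : Fin a) → toℕ (to (Fin-cong e) i) ≡ toℕ i
toℕ-Fin-cong refl i = refl

Σ-Fin-≡ : ∀ {A : Set} {ℓ : A → ℕ} {a a' : A} {i : Fin (ℓ a)} {i' : Fin (ℓ a')} →
          a ≡ a' → toℕ i ≡ toℕ i' → _≡_ {A = Σ A (λ x → Fin (ℓ x))} (a , i) (a' , i')
Σ-Fin-≡ refl q = cong (_ ,_) (toℕ-injective q)

-- Lists of length n satisfying a Boolean predicate P.  The families 𝓛 and 𝓓
-- of the statement are encoded by vectors; all combinatorics is done on lists.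
record Sized {A : Set} (P : List A → Bool) (n : ℕ) : Set where
  constructor sized
  field
    list  : List A
    valid : T (P list)
    size  : length list ≡ n
open Sized using (list)

Sized-≡ : ∀ {A : Set} {P : List A → Bool} {n} {a b : Sized P n} → list a ≡ list b → a ≡ b
Sized-≡ {a = sized w p q} {sized .w p' q'} refl = cong₂ (sized w) (T-irrelevant p p') (≡-irrelevant q q')

ΣT-≡ : ∀ {A : Set} {B : A → Bool} {x y : Σ A (λ a → T (B a))} → proj₁ x ≡ proj₁ y → x ≡ y
ΣT-≡ {x = a , p} {.a , q} refl = cong (a ,_) (T-irrelevant p q)

toVec : ∀ {A : Set} {n} (xs : List A) → length xs ≡ n → Vec A n
toVec xs refl = fromList xs

toList-toVec : ∀ {A : Set} {n} (xs : List A) (e : length xs ≡ n) → toList (toVec xs e) ≡ xs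
toList-toVec xs refl = toList∘fromList xs

vec↔sized : ∀ {A : Set} (P : List A → Bool) n → Σ (Vec A n) (λ v → T (P (toList v))) ↔ Sized P n
vec↔sized P n = mk↔ₛ′ toSized fromSized (λ { (sized w p l) → Sized-≡ (toList-toVec w l) }) fromTo
  where
  toSized : Σ (Vec _ n) (λ v → T (P (toList v))) → Sized P n
  toSized (v , p) = sized (toList v) p (length-toList v)
  fromSized : Sized P n → Σ (Vec _ n) (λ v → T (P (toList v)))
  fromSized (sized w p l) = toVec w l , subst (λ x → T (P x)) (sym (toList-toVec w l)) p
  fromTo : ∀ x → fromSized (toSized x) ≡ x
  fromTo (v , p) = ΣT-≡ (trans (sym (cast-is-id refl _))
                               (toList-injective refl _ v (toList-toVec (toList v) (length-toList v))))

Sized-cong : ∀ {A : Set} {P Q : List A → Bool} n →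
             (∀ w → length w ≡ n → P w ≡ Q w) → Sized P n ↔ Sized Q n
Sized-cong n P≡Q = mk↔ₛ′
  (λ { (sized w p l) → sized w (subst T (P≡Q w l) p) l })
  (λ { (sized w q l) → sized w (subst T (sym (P≡Q w l)) q) l })
  (λ _ → Sized-≡ refl) (λ _ → Sized-≡ refl)

partition : ∀ {A : Set} (P Q : List A → Bool) n →
            Sized P n ↔ (Sized (λ w → not (Q w) ∧ P w) n ⊎ Sized (λ w → Q w ∧ P w) n)
partition P Q n = mk↔ₛ′ (λ { (sized w p l) → classify w p l (Q w) refl }) merge split-merge merge-split
  where
  Parts = Sized (λ w → not (Q w) ∧ P w) n ⊎ Sized (λ w → Q w ∧ P w) n
  classify : ∀ w → T (P w) → length w ≡ n → ∀ b → Q w ≡ b → Parts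
  classify w p l false e = inj₁ (sized w (subst (λ b → T (not b ∧ P w)) (sym e) p) l)
  classify w p l true e = inj₂ (sized w (subst (λ b → T (b ∧ P w)) (sym e) p) l)
  merge : Parts → Sized P n
  merge (inj₁ (sized w p l)) = sized w (proj₂ (Equivalence.to T-∧ p)) l
  merge (inj₂ (sized w p l)) = sized w (proj₂ (Equivalence.to T-∧ p)) l
  merge-classify : ∀ w p l b e → merge (classify w p l b e) ≡ sized w p l
  merge-classify w p l false e = Sized-≡ refl
  merge-classify w p l true e = Sized-≡ refl
  merge-split : ∀ x → merge (classify (list x) _ _ _ refl) ≡ x
  merge-split (sized w p l) = merge-classify w p l (Q w) refl
  split-merge : ∀ y → classify (list (merge y)) _ _ _ refl ≡ y
  split-merge (inj₁ (sized w p l)) = byQ (Q w) refl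
    where
    byQ : ∀ b (e : Q w ≡ b) → classify w (proj₂ (Equivalence.to T-∧ p)) l b e ≡ inj₁ (sized w p l)
    byQ false e = cong inj₁ (Sized-≡ refl)
    byQ true e = ⊥-elim (subst (λ b → T (not b ∧ P w)) e p)
  split-merge (inj₂ (sized w p l)) = byQ (Q w) refl
    where
    byQ : ∀ b (e : Q w ≡ b) → classify w (proj₂ (Equivalence.to T-∧ p)) l b e ≡ inj₂ (sized w p l)
    byQ true e = cong inj₂ (Sized-≡ refl)
    byQ false e = ⊥-elim (subst (λ b → T (b ∧ P w)) e p)

inj₂≢inj₁ : ∀ {A : Set} {a : A} → inj₂ a ≢ inj₁ tt
inj₂≢inj₁ ()

-- Cancelling a common point: from f : (⊤ ⊎ A) ↔ (⊤ ⊎ B), send a ∈ A to f(a),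
-- unless that is the extra point, in which case to the image of the extra
-- point (which then lies in B).
module _ {A B : Set} (f : (⊤ ⊎ A) ↔ (⊤ ⊎ B)) where
  private
    pick : (r s : ⊤ ⊎ B) → .(r ≡ inj₁ tt → s ≡ inj₁ tt → ⊥) → B
    pick (inj₂ b) _ _ = b
    pick (inj₁ tt) (inj₂ b) _ = b
    pick (inj₁ tt) (inj₁ tt) both = ⊥-elim-irr (both refl refl)

    pick-here : ∀ {r s : ⊤ ⊎ B} {b} .{ne} → r ≡ inj₂ b → pick r s ne ≡ b
    pick-here refl = refl

    pick-there : ∀ {r s : ⊤ ⊎ B} {b} .{ne} → r ≡ inj₁ tt → s ≡ inj₂ b → pick r s ne ≡ b
    pick-there refl refl = refl

  remainder : A → B
  remainder a = pick (to f (inj₂ a)) (to f (inj₁ tt))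
    (λ p q → inj₂≢inj₁ (trans (sym (inverseʳ f (sym p))) (inverseʳ f (sym q))))

  remainder-here : ∀ a b → to f (inj₂ a) ≡ inj₂ b → remainder a ≡ b
  remainder-here a b e = pick-here e

  remainder-there : ∀ a b → to f (inj₂ a) ≡ inj₁ tt → to f (inj₁ tt) ≡ inj₂ b → remainder a ≡ b
  remainder-there a b e e' = pick-there e e'

remainder-inverse : ∀ {A B : Set} (f : (⊤ ⊎ A) ↔ (⊤ ⊎ B)) a → remainder (↔-sym f) (remainder f a) ≡ a
remainder-inverse f a = byImage (to f (inj₂ a)) refl
  where
  byImage : ∀ r → to f (inj₂ a) ≡ r → remainder (↔-sym f) (remainder f a) ≡ a
  byImage (inj₂ b) e =
    trans (cong (remainder (↔-sym f)) (remainder-here f a b e))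
          (remainder-here (↔-sym f) b a (inverseʳ f (sym e)))
  byImage (inj₁ tt) e = byPointImage (to f (inj₁ tt)) refl
    where
    byPointImage : ∀ s → to f (inj₁ tt) ≡ s → remainder (↔-sym f) (remainder f a) ≡ a
    byPointImage (inj₂ b) e' =
      trans (cong (remainder (↔-sym f)) (remainder-there f a b e e'))
            (remainder-there (↔-sym f) b a (inverseʳ f (sym e')) (inverseʳ f (sym e)))
    byPointImage (inj₁ tt) e' = ⊥-elim (inj₂≢inj₁ (trans (sym (inverseʳ f (sym e))) (inverseʳ f (sym e'))))

cancel-⊤ : ∀ {A B : Set} → (⊤ ⊎ A) ↔ (⊤ ⊎ B) → A ↔ B
cancel-⊤ f = mk↔ₛ′ (remainder f) (remainder (↔-sym f)) (remainder-inverse (↔-sym f)) (remainder-inverse f)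

cancel-Fin : ∀ k {A B : Set} → (Fin k ⊎ A) ↔ (Fin k ⊎ B) → A ↔ B
cancel-Fin zero f = ↔-trans (↔-sym Fin0-⊎) (↔-trans f Fin0-⊎)
  where
  Fin0-⊎ : ∀ {C : Set} → (Fin 0 ⊎ C) ↔ C
  Fin0-⊎ = mk↔ₛ′ (λ { (inj₁ ()) ; (inj₂ c) → c }) inj₂ (λ _ → refl) (λ { (inj₁ ()) ; (inj₂ c) → refl })
cancel-Fin (suc k) f = cancel-Fin k (cancel-⊤ (↔-trans (↔-sym (peel _)) (↔-trans f (peel _))))
  where
  peel : ∀ C → (Fin (suc k) ⊎ C) ↔ (⊤ ⊎ (Fin k ⊎ C))
  peel C = ↔-trans (⊎-cong (↔-trans (+↔⊎ {1} {k}) (⊎-cong 1↔⊤ ↔-refl)) ↔-refl) (⊎-assoc 0ℓ ⊤ (Fin k) C)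

-- A generating tree with the succession rule (k) ⇝ (2)(3)⋯(k+1): objects of
-- size n+1 correspond to pairs of an object x of size n and an index
-- i < label x, and the object for (x , i) has label i + 2.
record GeneratingTree : Set₁ where
  field
    Node      : ℕ → Set
    label     : ∀ {n} → Node n → ℕ
    split     : ∀ n → Node (suc n) ↔ Σ (Node n) (λ x → Fin (label x))
    label-child : ∀ n (x : Node n) (i : Fin (label x)) →
                  label (from (split n) (x , i)) ≡ suc (suc (toℕ i))

module _ (A B : GeneratingTree) where
  private
    module A = GeneratingTree A
    module B = GeneratingTree B

  LabelIso : ℕ → Set
  LabelIso n = Σ (A.Node n ↔ B.Node n) (λ f → ∀ x → B.label (to f x) ≡ A.label x)

  treeIso : LabelIso 0 → ∀ n → LabelIso n
  treeIso root zero = root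
  treeIso root (suc n) = g , label-g
    where
    f = proj₁ (treeIso root n)
    label-f = proj₂ (treeIso root n)
    g : A.Node (suc n) ↔ B.Node (suc n)
    g = ↔-trans (A.split n) (↔-trans (Σ-↔ f (Fin-cong (sym (label-f _)))) (↔-sym (B.split n)))
    label-g : ∀ x → B.label (to g x) ≡ A.label x
    label-g x = begin
        B.label (to g x)
      ≡⟨ B.label-child n (to f y) (to (Fin-cong e) i) ⟩
        suc (suc (toℕ (to (Fin-cong e) i)))
      ≡⟨ cong (λ k → suc (suc k)) (toℕ-Fin-cong e i) ⟩
        suc (suc (toℕ i))
      ≡⟨ A.label-child n y i ⟨
        A.label (from (A.split n) (y , i))
      ≡⟨ cong A.label (strictlyInverseʳ (A.split n) x) ⟩
        A.label x ∎
      where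
      open ≡-Reasoning
      y = proj₁ (to (A.split n) x)
      i = proj₂ (to (A.split n) x)
      e = sym (label-f y)

Ns : ℕ → List Step
Ns zero = []
Ns (suc k) = N ∷ Ns k

leadingNs : List Step → ℕ
leadingNs (N ∷ w) = suc (leadingNs w)
leadingNs _ = 0

afterNs : List Step → List Step
afterNs (N ∷ w) = afterNs w
afterNs w = w

Ns-leadingNs : ∀ w → Ns (leadingNs w) ++ afterNs w ≡ w
Ns-leadingNs [] = refl
Ns-leadingNs (N ∷ w) = cong (N ∷_) (Ns-leadingNs w)
Ns-leadingNs (E ∷ w) = refl

dyckFrom-Ns : ∀ h k r → dyckFrom h (Ns k ++ r) ≡ dyckFrom (k + h) r
dyckFrom-Ns h zero r = refl
dyckFrom-Ns h (suc k) r = trans (dyckFrom-Ns (suc h) k r) (cong (λ x → dyckFrom x r) (+-suc k h))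

leadingNs-Ns : ∀ k r → leadingNs (Ns k ++ r) ≡ k + leadingNs r
leadingNs-Ns zero r = refl
leadingNs-Ns (suc k) r = cong suc (leadingNs-Ns k r)

afterNs-Ns : ∀ k r → afterNs (Ns k ++ r) ≡ afterNs r
afterNs-Ns zero r = refl
afterNs-Ns (suc k) r = afterNs-Ns k r

Ns-++ : ∀ a b r → Ns a ++ (Ns b ++ r) ≡ Ns (a + b) ++ r
Ns-++ zero b r = refl
Ns-++ (suc a) b r = cong (N ∷_) (Ns-++ a b r)

length-Ns : ∀ k r → length (Ns k ++ r) ≡ k + length r
length-Ns zero r = refl
length-Ns (suc k) r = cong suc (length-Ns k r)

leadingNs-peak : ∀ k r → leadingNs (Ns k ++ E ∷ r) ≡ k
leadingNs-peak k r = trans (leadingNs-Ns k (E ∷ r)) (+-identityʳ k)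

afterNs-peak : ∀ k r → afterNs (Ns k ++ E ∷ r) ≡ E ∷ r
afterNs-peak k r = afterNs-Ns k (E ∷ r)

peakFrom : ∀ h w → T (dyckFrom (suc h) w) → Σ ℕ λ e → Σ (List Step) λ u → w ≡ Ns e ++ E ∷ u
peakFrom h (N ∷ w) d with peakFrom (suc h) w d
... | e , u , eq = suc e , u , cong (N ∷_) eq
peakFrom h (E ∷ u) d = zero , u , refl

firstPeak : ∀ w → T (dyckFrom 0 w) → 0 < length w → Σ ℕ λ e → Σ (List Step) λ u → w ≡ Ns (suc e) ++ E ∷ u
firstPeak (N ∷ w) d _ with peakFrom 0 w d
... | e , u , eq = e , u , cong (N ∷_) eq

-- addPeak j w inserts a peak NE after the first j steps of the initial run of w;
-- removePeak deletes the first peak.  These are the child and parent maps of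
-- the generating tree of Dyck paths.
addPeak : ℕ → List Step → List Step
addPeak j w = Ns (suc j) ++ E ∷ (Ns (leadingNs w ∸ j) ++ afterNs w)

removePeak : List Step → List Step
removePeak w = Ns (pred (leadingNs w)) ++ drop 1 (afterNs w)

addPeak-dyck : ∀ w j → j ≤ leadingNs w → dyckFrom 0 (addPeak j w) ≡ dyckFrom 0 w
addPeak-dyck w j j≤ = begin
    dyckFrom 0 (Ns (suc j) ++ E ∷ (Ns (r ∸ j) ++ afterNs w))
  ≡⟨ dyckFrom-Ns 0 (suc j) _ ⟩
    dyckFrom (j + 0) (Ns (r ∸ j) ++ afterNs w)
  ≡⟨ dyckFrom-Ns (j + 0) (r ∸ j) _ ⟩
    dyckFrom (r ∸ j + (j + 0)) (afterNs w)
  ≡⟨ cong (λ x → dyckFrom x (afterNs w)) (trans (sym (+-assoc (r ∸ j) j 0)) (cong (_+ 0) (m∸n+n≡m j≤))) ⟩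
    dyckFrom (r + 0) (afterNs w)
  ≡⟨ dyckFrom-Ns 0 r _ ⟨
    dyckFrom 0 (Ns r ++ afterNs w)
  ≡⟨ cong (dyckFrom 0) (Ns-leadingNs w) ⟩
    dyckFrom 0 w ∎
  where
  open ≡-Reasoning
  r = leadingNs w

addPeak-length : ∀ w j → j ≤ leadingNs w → length (addPeak j w) ≡ 2 + length w
addPeak-length w j j≤ = begin
    length (Ns (suc j) ++ E ∷ (Ns (r ∸ j) ++ afterNs w))
  ≡⟨ length-Ns (suc j) _ ⟩
    suc j + suc (length (Ns (r ∸ j) ++ afterNs w))
  ≡⟨ cong (λ x → suc j + suc x) (length-Ns (r ∸ j) _) ⟩
    suc j + suc (r ∸ j + length (afterNs w))
  ≡⟨ cong suc (+-suc j _) ⟩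
    2 + (j + (r ∸ j + length (afterNs w)))
  ≡⟨ cong (2 +_) (trans (sym (+-assoc j _ _)) (cong (_+ length (afterNs w)) (m+[n∸m]≡n j≤))) ⟩
    2 + (r + length (afterNs w))
  ≡⟨ cong (2 +_) (length-Ns r _) ⟨
    2 + length (Ns r ++ afterNs w)
  ≡⟨ cong (λ x → 2 + length x) (Ns-leadingNs w) ⟩
    2 + length w ∎
  where
  open ≡-Reasoning
  r = leadingNs w

removePeak-peak : ∀ e u → removePeak (Ns (suc e) ++ E ∷ u) ≡ Ns e ++ u
removePeak-peak e u rewrite leadingNs-peak e u | afterNs-peak e u = refl

removePeak-addPeak : ∀ w j → j ≤ leadingNs w → removePeak (addPeak j w) ≡ w
removePeak-addPeak w j j≤ = begin
    removePeak (Ns (suc j) ++ E ∷ (Ns (leadingNs w ∸ j) ++ afterNs w))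
  ≡⟨ removePeak-peak j _ ⟩
    Ns j ++ (Ns (leadingNs w ∸ j) ++ afterNs w)
  ≡⟨ Ns-++ j _ _ ⟩
    Ns (j + (leadingNs w ∸ j)) ++ afterNs w
  ≡⟨ cong (λ x → Ns x ++ afterNs w) (m+[n∸m]≡n j≤) ⟩
    Ns (leadingNs w) ++ afterNs w
  ≡⟨ Ns-leadingNs w ⟩
    w ∎
  where open ≡-Reasoning

addPeak-leadingNs : ∀ w j → leadingNs (addPeak j w) ≡ suc j
addPeak-leadingNs w j = leadingNs-peak (suc j) _

addPeak-removePeak : ∀ w → T (dyckFrom 0 w) → 0 < length w →
  pred (leadingNs w) ≤ leadingNs (removePeak w) × addPeak (pred (leadingNs w)) (removePeak w) ≡ w
addPeak-removePeak w d w≠[] with firstPeak w d w≠[]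
... | e , u , refl =
  subst₂ Parent (sym (cong pred (leadingNs-peak (suc e) u))) (sym (removePeak-peak e u))
         (subst (e ≤_) (sym (leadingNs-Ns e u)) (m≤m+n e _) , addPeak-Ns)
  where
  Parent : ℕ → List Step → Set
  Parent k v = k ≤ leadingNs v × addPeak k v ≡ Ns (suc e) ++ E ∷ u
  addPeak-Ns : addPeak e (Ns e ++ u) ≡ Ns (suc e) ++ E ∷ u
  addPeak-Ns rewrite leadingNs-Ns e u | afterNs-Ns e u | m+n∸m≡n e (leadingNs u) | Ns-leadingNs u = refl

-- Dyck paths of semilength n as lists; the label of a path, one more than the
-- length of its initial run, is the number of places for a new first peak.
DyckList : ℕ → Set
DyckList n = Sized (dyckFrom 0) (2 * n)

dyckLabel : ∀ {m} → Sized (dyckFrom 0) m → ℕ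
dyckLabel x = suc (leadingNs (list x))

dyckSplit : ∀ n → DyckList (suc n) ↔ Σ (DyckList n) (λ x → Fin (dyckLabel x))
dyckSplit n = mk↔ₛ′ parent child parent-child child-parent
  where
  nonempty : ∀ (w : List Step) → length w ≡ 2 * suc n → 0 < length w
  nonempty w l = subst (0 <_) (sym l) (s≤s z≤n)
  child : Σ (DyckList n) (λ x → Fin (dyckLabel x)) → DyckList (suc n)
  child (sized w d l , j) = sized (addPeak (toℕ j) w)
    (subst T (sym (addPeak-dyck w (toℕ j) j≤)) d)
    (trans (addPeak-length w (toℕ j) j≤) (trans (cong (2 +_) l) (sym (*-suc 2 n))))
    where j≤ = ≤-pred (toℕ<n j)
  parent : DyckList (suc n) → Σ (DyckList n) (λ x → Fin (dyckLabel x))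
  parent (sized w d l) =
    sized (removePeak w) (subst T (addPeak-dyck (removePeak w) k bound) (subst (λ v → T (dyckFrom 0 v)) (sym shape) d))
      (suc-injective (suc-injective (begin
        2 + length (removePeak w)          ≡⟨ addPeak-length (removePeak w) k bound ⟨
        length (addPeak k (removePeak w))  ≡⟨ cong length shape ⟩
        length w                           ≡⟨ l ⟩
        2 * suc n                          ≡⟨ *-suc 2 n ⟩
        2 + 2 * n                          ∎)))
    , fromℕ< (s≤s bound)
    where
    open ≡-Reasoning
    k = pred (leadingNs w)
    decomposition = addPeak-removePeak w d (nonempty w l)
    bound = proj₁ decomposition
    shape = proj₂ decomposition
  parent-child : ∀ y → parent (child y) ≡ y
  parent-child (sized w d l , j) =
    Σ-Fin-≡ (Sized-≡ (removePeak-addPeak w (toℕ j) (≤-pred (toℕ<n j))))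
            (trans (toℕ-fromℕ< _) (cong pred (addPeak-leadingNs w (toℕ j))))
  child-parent : ∀ x → child (parent x) ≡ x
  child-parent (sized w d l) =
    Sized-≡ (trans (cong (λ j → addPeak j (removePeak w)) (toℕ-fromℕ< _))
                   (proj₂ (addPeak-removePeak w d (nonempty w l))))

dyckTree : GeneratingTree
dyckTree = record
  { Node = DyckList
  ; label = dyckLabel
  ; split = dyckSplit
  ; label-child = λ n x i → cong suc (addPeak-leadingNs (list x) (toℕ i))
  }

true≢false : true ≢ false
true≢false ()

T⇒≡true : ∀ {b} → T b → b ≡ true
T⇒≡true = Equivalence.to T-≡

≡true⇒T : ∀ {b} → b ≡ true → T b
≡true⇒T = Equivalence.from T-≡

¬T⇒≡false : ∀ {b} → ¬ T b → b ≡ false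
¬T⇒≡false {false} _ = refl
¬T⇒≡false {true} ¬t = ⊥-elim (¬t _)

∧-true⁻ : ∀ {a b} → (a ∧ b) ≡ true → a ≡ true × b ≡ true
∧-true⁻ {true} {true} p = refl , refl

∨-false⁻ : ∀ {a b} → (a ∨ b) ≡ false → a ≡ false × b ≡ false
∨-false⁻ {false} {false} p = refl , refl

∧-swap : ∀ x y z → x ∧ (y ∧ z) ≡ y ∧ (x ∧ z)
∧-swap true y z = refl
∧-swap false true z = refl
∧-swap false false z = refl

≡ᵇ-refl : ∀ n → (n ≡ᵇ n) ≡ true
≡ᵇ-refl n = T⇒≡true (≡⇒≡ᵇ n n refl)

≡ᵇ-true⇒≡ : ∀ m n → (m ≡ᵇ n) ≡ true → m ≡ n
≡ᵇ-true⇒≡ m n p = ≡ᵇ⇒≡ m n (≡true⇒T p)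

≢⇒≡ᵇ-false : ∀ m n → m ≢ n → (m ≡ᵇ n) ≡ false
≢⇒≡ᵇ-false m n m≢n with m ≡ᵇ n in e
... | false = refl
... | true = ⊥-elim (m≢n (≡ᵇ-true⇒≡ m n e))

≡ᵇ-false⇒≢ : ∀ {m n} → (m ≡ᵇ n) ≡ false → m ≢ n
≡ᵇ-false⇒≢ {m} p refl = true≢false (trans (sym (≡ᵇ-refl m)) p)

≤⇒≤ᵇ-true : ∀ {m n} → m ≤ n → (m ≤ᵇ n) ≡ true
≤⇒≤ᵇ-true m≤n = T⇒≡true (≤⇒≤ᵇ m≤n)

≤ᵇ-true⇒≤ : ∀ m n → (m ≤ᵇ n) ≡ true → m ≤ n
≤ᵇ-true⇒≤ m n p = ≤ᵇ⇒≤ m n (≡true⇒T p)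

∈-++ : ∀ k xs ys → k ∈ᵇ (xs ++ ys) ≡ (k ∈ᵇ xs) ∨ (k ∈ᵇ ys)
∈-++ k [] ys = refl
∈-++ k (x ∷ xs) ys = trans (cong ((x ≡ᵇ k) ∨_) (∈-++ k xs ys)) (sym (∨-assoc (x ≡ᵇ k) _ _))

∈-++ˡ : ∀ k xs ys → k ∈ᵇ xs ≡ true → k ∈ᵇ (xs ++ ys) ≡ true
∈-++ˡ k xs ys p rewrite ∈-++ k xs ys | p = refl

∈-snoc : ∀ k xs v → k ≢ v → k ∈ᵇ (xs ++ [ v ]) ≡ k ∈ᵇ xs
∈-snoc k xs v k≢v = begin
  k ∈ᵇ (xs ++ [ v ])            ≡⟨ ∈-++ k xs [ v ] ⟩
  (k ∈ᵇ xs) ∨ ((v ≡ᵇ k) ∨ false) ≡⟨ cong (λ b → (k ∈ᵇ xs) ∨ (b ∨ false)) (≢⇒≡ᵇ-false v k (≢-sym k≢v)) ⟩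
  (k ∈ᵇ xs) ∨ false              ≡⟨ ∨-identityʳ _ ⟩
  k ∈ᵇ xs                        ∎
  where open ≡-Reasoning

∈-here : ∀ k xs → k ∈ᵇ (k ∷ xs) ≡ true
∈-here k xs rewrite ≡ᵇ-refl k = refl

count : ℕ → List ℕ → ℕ
count v [] = 0
count v (x ∷ xs) = if x ≡ᵇ v then suc (count v xs) else count v xs

count-++ : ∀ v xs ys → count v (xs ++ ys) ≡ count v xs + count v ys
count-++ v [] ys = refl
count-++ v (x ∷ xs) ys with x ≡ᵇ v
... | true = cong suc (count-++ v xs ys)
... | false = count-++ v xs ys

count-∷-≤ : ∀ w x xs → count w xs ≤ count w (x ∷ xs)
count-∷-≤ w x xs with x ≡ᵇ w
... | true = n≤1+n _
... | false = ≤-refl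

count-here : ∀ v xs → count v (v ∷ xs) ≡ suc (count v xs)
count-here v xs rewrite ≡ᵇ-refl v = refl

count-insert : ∀ v xs zs → count v (xs ++ v ∷ zs) ≡ suc (count v (xs ++ zs))
count-insert v xs zs rewrite count-++ v xs (v ∷ zs) | count-++ v xs zs | ≡ᵇ-refl v = +-suc _ _

count≡0⇒∉ : ∀ v xs → count v xs ≡ 0 → v ∈ᵇ xs ≡ false
count≡0⇒∉ v [] p = refl
count≡0⇒∉ v (x ∷ xs) p with x ≡ᵇ v
... | false = count≡0⇒∉ v xs p

∉⇒count≡0 : ∀ v xs → v ∈ᵇ xs ≡ false → count v xs ≡ 0
∉⇒count≡0 v [] p = refl
∉⇒count≡0 v (x ∷ xs) p with x ≡ᵇ v
... | false = ∉⇒count≡0 v xs p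

count>0⇒∈ : ∀ v xs → 0 < count v xs → v ∈ᵇ xs ≡ true
count>0⇒∈ v (x ∷ xs) p with x ≡ᵇ v
... | true = refl
... | false = count>0⇒∈ v xs p

∈⇒count>0 : ∀ v xs → v ∈ᵇ xs ≡ true → 0 < count v xs
∈⇒count>0 v (x ∷ xs) p with x ≡ᵇ v
... | true = s≤s z≤n
... | false = ∈⇒count>0 v xs p

maxOf : List ℕ → ℕ
maxOf [] = 0
maxOf (x ∷ xs) = x ⊔ maxOf xs

All≤maxOf : ∀ xs → All (_≤ maxOf xs) xs
All≤maxOf [] = []
All≤maxOf (x ∷ xs) = m≤m⊔n x (maxOf xs) ∷ All.map (λ p → ≤-trans p (m≤n⊔m x (maxOf xs))) (All≤maxOf xs)

maxOf-lub : ∀ {v} xs → All (_≤ v) xs → maxOf xs ≤ v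
maxOf-lub [] [] = z≤n
maxOf-lub (x ∷ xs) (p ∷ ps) = ⊔-lub p (maxOf-lub xs ps)

maxOf-∷-∈ : ∀ x xs → maxOf (x ∷ xs) ∈ᵇ (x ∷ xs) ≡ true
maxOf-∷-∈ x [] rewrite ⊔-identityʳ x | ≡ᵇ-refl x = refl
maxOf-∷-∈ x (y ∷ ys) with ⊔-sel x (maxOf (y ∷ ys))
... | inj₁ e rewrite e | ≡ᵇ-refl x = refl
... | inj₂ e rewrite e = trans (cong ((x ≡ᵇ maxOf (y ∷ ys)) ∨_) (maxOf-∷-∈ y ys)) (∨-zeroʳ _)

maxOf-∈ : ∀ xs → xs ≢ [] → maxOf xs ∈ᵇ xs ≡ true
maxOf-∈ [] xs≢[] = ⊥-elim (xs≢[] refl)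
maxOf-∈ (x ∷ xs) _ = maxOf-∷-∈ x xs

All≤-∈ : ∀ {v k} xs → All (_≤ v) xs → k ∈ᵇ xs ≡ true → k ≤ v
All≤-∈ {v} {k} (x ∷ xs) (p ∷ ps) q with x ≡ᵇ k in e
... | true = subst (_≤ v) (≡ᵇ-true⇒≡ x k e) p
... | false = All≤-∈ xs ps q

maxOf-attained : ∀ {M} xs → All (_≤ M) xs → M ∈ᵇ xs ≡ true → maxOf xs ≡ M
maxOf-attained xs al m = ≤-antisym (maxOf-lub xs al) (All≤-∈ xs (All≤maxOf xs) m)

maxOf-insert : ∀ v xs zs → All (_≤ v) xs → All (_≤ v) zs → maxOf (xs ++ v ∷ zs) ≡ v
maxOf-insert v xs zs xs≤ zs≤ = maxOf-attained (xs ++ v ∷ zs) (++⁺ xs≤ (≤-refl ∷ zs≤))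
  (trans (∈-++ v xs (v ∷ zs)) (trans (cong ((v ∈ᵇ xs) ∨_) (∈-here v zs)) (∨-zeroʳ _)))

suc∉ : ∀ M xs → All (_≤ M) xs → suc M ∈ᵇ xs ≡ false
suc∉ M xs al with suc M ∈ᵇ xs in e
... | false = refl
... | true = ⊥-elim (1+n≰n (All≤-∈ xs al e))

All≤-suc : ∀ {M} xs → All (_≤ M) xs → All (_≤ suc M) xs
All≤-suc xs al = All.map (λ p → ≤-trans p (n≤1+n _)) al

All≤-pred : ∀ M l → All (_≤ suc M) l → suc M ∈ᵇ l ≡ false → All (_≤ M) l
All≤-pred M [] al n = []
All≤-pred M (x ∷ l) (p ∷ al) n =
  ≤-pred (≤∧≢⇒< p (≡ᵇ-false⇒≢ (proj₁ (∨-false⁻ n)))) ∷ All≤-pred M l al (proj₂ (∨-false⁻ n))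

All≤0-empty : ∀ xs → All (_≤ 0) xs → 0 ∈ᵇ xs ≡ false → xs ≡ []
All≤0-empty [] al n = refl
All≤0-empty (zero ∷ xs) al n = ⊥-elim (true≢false n)
All≤0-empty (suc x ∷ xs) (() ∷ al) n

-- Inserting a value v that is at least every entry and
-- has no v to its right changes the two defining conditions of 𝓛 only locally:
-- condition (1) additionally requires that v fits before the next entry, and
-- condition (2) additionally requires that v, if it is a leftmost occurrence,
-- has v - 1 on both sides.

fitsBefore : ℕ → List ℕ → Bool
fitsBefore v [] = true
fitsBefore v (y ∷ ys) = v ≤ᵇ suc y

leftmostOK : ℕ → List ℕ → List ℕ → Bool
leftmostOK zero pre rest = true
leftmostOK (suc k) pre rest = if suc k ∈ᵇ pre then true else ((k ∈ᵇ pre) ∧ (k ∈ᵇ rest))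

cond1-insert : ∀ v xs ys → All (_≤ v) xs → cond1 (xs ++ v ∷ ys) ≡ fitsBefore v ys ∧ cond1 (xs ++ ys)
cond1-insert v [] [] al = refl
cond1-insert v [] (y ∷ ys) al = refl
cond1-insert v (x ∷ []) ys (x≤v ∷ []) rewrite ≤⇒≤ᵇ-true (≤-trans x≤v (n≤1+n v)) = lastStep ys
  where
  lastStep : ∀ ys → cond1 (v ∷ ys) ≡ fitsBefore v ys ∧ cond1 (x ∷ ys)
  lastStep [] = refl
  lastStep (y ∷ ys) with v ≤ᵇ suc y in e
  ... | false = refl
  ... | true rewrite ≤⇒≤ᵇ-true (≤-trans x≤v (≤ᵇ-true⇒≤ v (suc y) e)) = refl
cond1-insert v (x ∷ x' ∷ xs) ys (p ∷ ps) =
  trans (cong ((x ≤ᵇ suc x') ∧_) (cond1-insert v (x' ∷ xs) ys ps)) (∧-swap (x ≤ᵇ suc x') (fitsBefore v ys) _)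

snoc-same : ∀ {v} x pre pre' → (∀ z → z ≢ v → z ∈ᵇ pre ≡ z ∈ᵇ pre') →
            ∀ z → z ≢ v → z ∈ᵇ (pre ++ [ x ]) ≡ z ∈ᵇ (pre' ++ [ x ])
snoc-same x pre pre' same z z≢v =
  trans (∈-++ z pre _) (trans (cong (_∨ _) (same z z≢v)) (sym (∈-++ z pre' _)))

cond2-prefix-cong : ∀ v pre pre' ys → (∀ z → z ≢ v → z ∈ᵇ pre ≡ z ∈ᵇ pre') →
                    v ∈ᵇ ys ≡ false → suc v ∈ᵇ ys ≡ false → cond2 pre ys ≡ cond2 pre' ys
cond2-prefix-cong v pre pre' [] same n1 n2 = refl
cond2-prefix-cong v pre pre' (zero ∷ ys) same n1 n2 =
  cond2-prefix-cong v (pre ++ [ zero ]) (pre' ++ [ zero ]) ys (snoc-same zero pre pre' same)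
    (proj₂ (∨-false⁻ n1)) (proj₂ (∨-false⁻ n2))
cond2-prefix-cong v pre pre' (suc k ∷ ys) same n1 n2 =
  cong₂ _∧_ here (cond2-prefix-cong v (pre ++ [ suc k ]) (pre' ++ [ suc k ]) ys (snoc-same (suc k) pre pre' same)
    (proj₂ (∨-false⁻ n1)) (proj₂ (∨-false⁻ n2)))
  where
  k≢v : k ≢ v
  k≢v e = ≡ᵇ-false⇒≢ (proj₁ (∨-false⁻ n2)) (cong suc e)
  here : leftmostOK (suc k) pre ys ≡ leftmostOK (suc k) pre' ys
  here rewrite same (suc k) (≡ᵇ-false⇒≢ (proj₁ (∨-false⁻ n1))) | same k k≢v = refl

cond2-snoc : ∀ v pre ys → v ∈ᵇ ys ≡ false → suc v ∈ᵇ ys ≡ false → cond2 (pre ++ [ v ]) ys ≡ cond2 pre ys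
cond2-snoc v pre ys n1 n2 = cond2-prefix-cong v (pre ++ [ v ]) pre ys (λ z q → ∈-snoc z pre v q) n1 n2

cond2-insert : ∀ v pre xs ys →
  suc v ∈ᵇ xs ≡ false → suc v ∈ᵇ ys ≡ false → v ∈ᵇ ys ≡ false →
  cond2 pre (xs ++ v ∷ ys) ≡ leftmostOK v (pre ++ xs) ys ∧ cond2 pre (xs ++ ys)
cond2-insert zero pre [] ys n1 n2 n3 = cond2-snoc zero pre ys n3 n2
cond2-insert (suc k) pre [] ys n1 n2 n3 =
  cong₂ _∧_ (cong (λ P → leftmostOK (suc k) P ys) (sym (++-identityʳ pre))) (cond2-snoc (suc k) pre ys n3 n2)
cond2-insert v pre (zero ∷ xs) ys n1 n2 n3 =
  trans (cond2-insert v (pre ++ [ zero ]) xs ys (proj₂ (∨-false⁻ n1)) n2 n3)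
        (cong (λ P → leftmostOK v P ys ∧ cond2 (pre ++ [ zero ]) (xs ++ ys)) (++-assoc pre [ zero ] xs))
cond2-insert v pre (suc j ∷ xs) ys n1 n2 n3 =
  trans (cong₂ _∧_ here (trans (cond2-insert v (pre ++ [ suc j ]) xs ys (proj₂ (∨-false⁻ n1)) n2 n3)
                            (cong (λ P → leftmostOK v P ys ∧ cond2 (pre ++ [ suc j ]) (xs ++ ys)) (++-assoc pre [ suc j ] xs))))
        (∧-swap (leftmostOK (suc j) pre (xs ++ ys)) (leftmostOK v (pre ++ suc j ∷ xs) ys) (cond2 (pre ++ [ suc j ]) (xs ++ ys)))
  where
  v≢j : v ≢ j
  v≢j e = ≡ᵇ-false⇒≢ (proj₁ (∨-false⁻ n1)) (cong suc (sym e))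
  here : leftmostOK (suc j) pre (xs ++ v ∷ ys) ≡ leftmostOK (suc j) pre (xs ++ ys)
  here rewrite ∈-++ j xs (v ∷ ys) | ≢⇒≡ᵇ-false v j v≢j | sym (∈-++ j xs ys) = refl

isL-insert : ∀ v xs ys → All (_≤ v) xs → All (_≤ v) ys → v ∈ᵇ ys ≡ false →
  isL (xs ++ v ∷ ys) ≡ (fitsBefore v ys ∧ leftmostOK v xs ys) ∧ isL (xs ++ ys)
isL-insert v xs ys xs≤ ys≤ v∉ys
  rewrite cond1-insert v xs ys xs≤ | cond2-insert v [] xs ys (suc∉ v xs xs≤) (suc∉ v ys ys≤) v∉ys =
  shuffle (fitsBefore v ys) (cond1 (xs ++ ys)) (leftmostOK v xs ys) (cond2 [] (xs ++ ys))
  where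
  shuffle : ∀ a b c d → (a ∧ b) ∧ (c ∧ d) ≡ (a ∧ c) ∧ (b ∧ d)
  shuffle true b true d = refl
  shuffle true b false d = ∧-zeroʳ b
  shuffle false b c d = refl

insert-valid : ∀ v xs ys → All (_≤ v) xs → All (_≤ v) ys → v ∈ᵇ ys ≡ false →
  fitsBefore v ys ≡ true → leftmostOK v xs ys ≡ true → T (isL (xs ++ ys)) → T (isL (xs ++ v ∷ ys))
insert-valid v xs ys xs≤ ys≤ v∉ys fits leftmost valid
  rewrite isL-insert v xs ys xs≤ ys≤ v∉ys | fits | leftmost = valid

insert-valid⁻ : ∀ v xs ys → All (_≤ v) xs → All (_≤ v) ys → v ∈ᵇ ys ≡ false → T (isL (xs ++ v ∷ ys)) →
  (fitsBefore v ys ≡ true × leftmostOK v xs ys ≡ true) × T (isL (xs ++ ys))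
insert-valid⁻ v xs ys xs≤ ys≤ v∉ys valid
  with ∧-true⁻ (trans (sym (isL-insert v xs ys xs≤ ys≤ v∉ys)) (T⇒≡true valid))
... | local , rest = ∧-true⁻ local , ≡true⇒T rest

-- Cutting and deleting.  countAfterLast v w a counts the w's after the last v
-- in a; cutAt t k a splits a = xs ++ zs just before the k-th occurrence of t
-- counted from the right (zs = [] when k = 0); plug v puts v into the cut;
-- deleteLast v removes the last occurrence of v.

countAfterLast : ℕ → ℕ → List ℕ → ℕ
countAfterLast v w [] = 0
countAfterLast v w (x ∷ xs) = if v ∈ᵇ xs then countAfterLast v w xs else count w xs

cutAt : ℕ → ℕ → List ℕ → List ℕ × List ℕ
cutAt t zero xs = xs , []
cutAt t (suc k) [] = [] , []
cutAt t (suc k) (x ∷ xs) =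
  if (x ≡ᵇ t) ∧ (count t xs ≡ᵇ k) then ([] , x ∷ xs)
  else (x ∷ proj₁ (cutAt t (suc k) xs) , proj₂ (cutAt t (suc k) xs))

plug : ℕ → List ℕ × List ℕ → List ℕ
plug v (xs , zs) = xs ++ v ∷ zs

deleteLast : ℕ → List ℕ → List ℕ
deleteLast v [] = []
deleteLast v (x ∷ xs) = if v ∈ᵇ xs then x ∷ deleteLast v xs else xs

CutHead : ℕ → ℕ → List ℕ → Set
CutHead t zero zs = zs ≡ []
CutHead t (suc k) zs = Σ (List ℕ) (λ zs' → zs ≡ t ∷ zs')

IsCut : ℕ → ℕ → List ℕ → List ℕ → List ℕ → Set
IsCut t k a xs zs = (xs ++ zs ≡ a) × (count t zs ≡ k) × CutHead t k zs

cutAt-spec : ∀ t k a → k ≤ count t a → IsCut t k a (proj₁ (cutAt t k a)) (proj₂ (cutAt t k a))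
cutAt-spec t zero a _ = ++-identityʳ a , refl , refl
cutAt-spec t (suc k) [] ()
cutAt-spec t (suc k) (x ∷ xs) le with x ≡ᵇ t in e1
... | false with cutAt-spec t (suc k) xs le
...   | (p1 , p2 , p3) = cong (x ∷_) p1 , p2 , p3
cutAt-spec t (suc k) (x ∷ xs) le | true with count t xs ≡ᵇ k in e2
... | true rewrite ≡ᵇ-true⇒≡ x t e1 | ≡ᵇ-refl t = refl , cong suc (≡ᵇ-true⇒≡ _ _ e2) , (xs , refl)
... | false with cutAt-spec t (suc k) xs le'
  where
  le' : suc k ≤ count t xs
  le' with m≤n⇒m<n∨m≡n (≤-pred le)
  ... | inj₁ lt = lt
  ... | inj₂ eq = ⊥-elim (≡ᵇ-false⇒≢ e2 (sym eq))
...   | (p1 , p2 , p3) = cong (x ∷_) p1 , p2 , p3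

cutAt-exact : ∀ t k xs zs' → count t zs' ≡ k → cutAt t (suc k) (xs ++ t ∷ zs') ≡ (xs , t ∷ zs')
cutAt-exact t k [] zs' c rewrite ≡ᵇ-refl t | c | ≡ᵇ-refl k = refl
cutAt-exact t k (x ∷ xs) zs' c with (x ≡ᵇ t) ∧ (count t (xs ++ t ∷ zs') ≡ᵇ k) in e
... | false rewrite cutAt-exact t k xs zs' c = refl
... | true = ⊥-elim (<⇒≢ more (sym (≡ᵇ-true⇒≡ _ k (proj₂ (∧-true⁻ {x ≡ᵇ t} e)))))
  where
  more : k < count t (xs ++ t ∷ zs')
  more rewrite count-insert t xs zs' | count-++ t xs zs' | c = s≤s (m≤n+m k _)

countAfterLast-insert : ∀ v w xs zs → v ∈ᵇ zs ≡ false → countAfterLast v w (xs ++ v ∷ zs) ≡ count w zs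
countAfterLast-insert v w [] zs n rewrite n = refl
countAfterLast-insert v w (x ∷ xs) zs n rewrite ∈-++ v xs (v ∷ zs) | ∈-here v zs | ∨-zeroʳ (v ∈ᵇ xs) =
  countAfterLast-insert v w xs zs n

countAfterLast-suffix : ∀ v w xs zs → v ∈ᵇ zs ≡ true → countAfterLast v w (xs ++ zs) ≡ countAfterLast v w zs
countAfterLast-suffix v w [] zs m = refl
countAfterLast-suffix v w (x ∷ xs) zs m rewrite ∈-++ v xs zs | m | ∨-zeroʳ (v ∈ᵇ xs) = countAfterLast-suffix v w xs zs m

countAfterLast≤count : ∀ v w xs → countAfterLast v w xs ≤ count w xs
countAfterLast≤count v w [] = z≤n
countAfterLast≤count v w (x ∷ xs) with v ∈ᵇ xs
... | true = ≤-trans (countAfterLast≤count v w xs) (count-∷-≤ w x xs)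
... | false = count-∷-≤ w x xs

count≤countAfterLast : ∀ v w xs zs → v ∈ᵇ xs ≡ true → v ∈ᵇ zs ≡ false → count w zs ≤ countAfterLast v w (xs ++ zs)
count≤countAfterLast v w (x ∷ xs) zs v∈ v∉ with v ∈ᵇ (xs ++ zs) in e
... | true = count≤countAfterLast v w xs zs v∈xs v∉
  where
  v∈xs : v ∈ᵇ xs ≡ true
  v∈xs with v ∈ᵇ xs in e'
  ... | true = refl
  ... | false = ⊥-elim (true≢false (trans (sym e) (trans (∈-++ v xs zs) (cong₂ _∨_ e' v∉))))
... | false = subst (count w zs ≤_) (sym (count-++ w xs zs)) (m≤n+m _ _)

countAfterLast-self : ∀ v xs → countAfterLast v v xs ≡ 0
countAfterLast-self v [] = refl
countAfterLast-self v (x ∷ xs) with v ∈ᵇ xs in e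
... | true = countAfterLast-self v xs
... | false = ∉⇒count≡0 v xs e

deleteLast-insert : ∀ v xs zs → v ∈ᵇ zs ≡ false → deleteLast v (xs ++ v ∷ zs) ≡ xs ++ zs
deleteLast-insert v [] zs n rewrite n = refl
deleteLast-insert v (x ∷ xs) zs n rewrite ∈-++ v xs (v ∷ zs) | ∈-here v zs | ∨-zeroʳ (v ∈ᵇ xs) =
  cong (x ∷_) (deleteLast-insert v xs zs n)

-- Its child with index j
-- inserts a new maximum M + 1 just before the (j+1)-th M from the right when
-- j + 1 < count M a, and otherwise inserts a further M just before the t-th
-- (M-1) from the right, t = j + 1 - count M a (at the end when t = 0).

wordLabel : List ℕ → ℕ
wordLabel a = count (maxOf a) a + countAfterLast (maxOf a) (maxOf a ∸ 1) a

childCase : ℕ → List ℕ → ℕ → Bool → List ℕ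
childCase M a j true = plug (suc M) (cutAt M (suc j) a)
childCase M a j false = plug M (cutAt (M ∸ 1) (suc j ∸ count M a) a)

wordChild : List ℕ → ℕ → List ℕ
wordChild a j = childCase (maxOf a) a j (suc j <ᵇ count (maxOf a) a)

wordParent : List ℕ → List ℕ
wordParent b = deleteLast (maxOf b) b

insert-label : ∀ v xs ys → All (_≤ v) xs → All (_≤ v) ys → v ∈ᵇ ys ≡ false →
  wordLabel (xs ++ v ∷ ys) ≡ suc (count v (xs ++ ys)) + count (v ∸ 1) ys
insert-label v xs ys xs≤ ys≤ v∉ys
  rewrite maxOf-insert v xs ys xs≤ ys≤ | count-insert v xs ys | countAfterLast-insert v (v ∸ 1) xs ys v∉ys = refl

insert-parent : ∀ v xs ys → All (_≤ v) xs → All (_≤ v) ys → v ∈ᵇ ys ≡ false → wordParent (xs ++ v ∷ ys) ≡ xs ++ ys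
insert-parent v xs ys xs≤ ys≤ v∉ys rewrite maxOf-insert v xs ys xs≤ ys≤ = deleteLast-insert v xs ys v∉ys

-- zs is empty or starts with v: the possible right neighbours of an inserted
-- maximum v + 1 that satisfy condition (1).
EmptyOrHead : ℕ → List ℕ → Set
EmptyOrHead v zs = zs ≡ [] ⊎ Σ (List ℕ) (λ zs' → zs ≡ v ∷ zs')

CutHead⇒EmptyOrHead : ∀ v k zs → CutHead v k zs → EmptyOrHead v zs
CutHead⇒EmptyOrHead v zero zs h = inj₁ h
CutHead⇒EmptyOrHead v (suc k) zs h = inj₂ h

fitsBefore-pred : ∀ M zs → EmptyOrHead (M ∸ 1) zs → fitsBefore M zs ≡ true
fitsBefore-pred M .[] (inj₁ refl) = refl
fitsBefore-pred zero .(0 ∷ zs') (inj₂ (zs' , refl)) = refl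
fitsBefore-pred (suc M) .(M ∷ zs') (inj₂ (zs' , refl)) = ≤⇒≤ᵇ-true (≤-refl {suc M})

tailShape : ∀ M zs → fitsBefore M zs ≡ true → All (_≤ M) zs → M ∈ᵇ zs ≡ false → EmptyOrHead (M ∸ 1) zs
tailShape M [] fits zs≤ M∉ = inj₁ refl
tailShape M (z ∷ zs) fits (z≤M ∷ _) M∉ = inj₂ (zs , cong (_∷ zs) (trans (sym (m+n∸m≡n 1 z)) (cong (_∸ 1) M≡z+1)))
  where
  M≡z+1 : suc z ≡ M
  M≡z+1 = ≤-antisym (≤∧≢⇒< z≤M (≡ᵇ-false⇒≢ (proj₁ (∨-false⁻ M∉)))) (≤ᵇ-true⇒≤ M (suc z) fits)

leftmostOK-repeat : ∀ M xs zs → M ∈ᵇ xs ≡ true → leftmostOK M xs zs ≡ true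
leftmostOK-repeat zero xs zs p = refl
leftmostOK-repeat (suc M) xs zs p rewrite p = refl

cut-back : ∀ v xs zs → EmptyOrHead v zs → cutAt v (count v zs) (xs ++ zs) ≡ (xs , zs)
cut-back v xs .[] (inj₁ refl) = cong (_, []) (++-identityʳ xs)
cut-back v xs .(v ∷ zs') (inj₂ (zs' , refl)) rewrite ≡ᵇ-refl v = cutAt-exact v (count v zs') xs zs' refl

max∉cut : ∀ M a xs zs t → xs ++ zs ≡ a → count (M ∸ 1) zs ≡ t → CutHead (M ∸ 1) t zs →
          t ≤ countAfterLast M (M ∸ 1) a → M ∈ᵇ zs ≡ false
max∉cut M a xs zs zero split count-t head t≤ rewrite head = refl
max∉cut zero a xs zs (suc t) split count-t head t≤ with ≤-trans t≤ (≤-reflexive (countAfterLast-self 0 a))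
... | ()
max∉cut (suc M) a xs zs (suc t) split count-t (zs' , head) t≤ with suc M ∈ᵇ zs in M∈zs
... | false = refl
... | true = ⊥-elim (<-irrefl refl (≤-trans t≤ bound))
  where
  M∈zs' : suc M ∈ᵇ zs' ≡ true
  M∈zs' = trans (cong (_∨ (suc M ∈ᵇ zs')) (sym (≢⇒≡ᵇ-false M (suc M) (<⇒≢ ≤-refl))))
                (trans (cong (suc M ∈ᵇ_) (sym head)) M∈zs)
  count-zs' : count M zs' ≡ t
  count-zs' = suc-injective (trans (sym (trans (cong (count M) head) (count-here M zs'))) count-t)
  bound : countAfterLast (suc M) M a ≤ t
  bound = begin
      countAfterLast (suc M) M a           ≡⟨ cong (countAfterLast (suc M) M) (sym split) ⟩
      countAfterLast (suc M) M (xs ++ zs)  ≡⟨ countAfterLast-suffix (suc M) M xs zs M∈zs ⟩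
      countAfterLast (suc M) M zs          ≡⟨ cong (countAfterLast (suc M) M) head ⟩
      countAfterLast (suc M) M (M ∷ zs')   ≡⟨ cong (λ b → if b then countAfterLast (suc M) M zs' else count M zs') M∈zs' ⟩
      countAfterLast (suc M) M zs'         ≤⟨ countAfterLast≤count (suc M) M zs' ⟩
      count M zs'                          ≡⟨ count-zs' ⟩
      t                                    ∎
    where open ≤-Reasoning

record ChildOK (a : List ℕ) (j : ℕ) (c : List ℕ) : Set where
  field
    cvalid : T (isL c)
    clen : length c ≡ suc (length a)
    clab : wordLabel c ≡ suc (suc j)
    cparent : wordParent c ≡ a

childNewMax : ∀ a → T (isL a) → ∀ j → suc j < count (maxOf a) a →
              ChildOK a j (plug (suc (maxOf a)) (cutAt (maxOf a) (suc j) a))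
childNewMax a valid j j<m = record
  { cvalid = insert-valid (suc M) xs zs xs≤ zs≤ M+1∉zs fits leftmost (subst (λ l → T (isL l)) (sym split) valid)
  ; clen = trans (length-++-sucʳ xs (suc M) zs) (cong (λ l → suc (length l)) split)
  ; clab = trans (insert-label (suc M) xs zs xs≤ zs≤ M+1∉zs) (cong₂ (λ p q → suc p + q) no-M+1 zs-count)
  ; cparent = trans (insert-parent (suc M) xs zs xs≤ zs≤ M+1∉zs) split
  }
  where
  M = maxOf a
  xs = proj₁ (cutAt M (suc j) a)
  zs = proj₂ (cutAt M (suc j) a)
  cut = cutAt-spec M (suc j) a (<⇒≤ j<m)
  split : xs ++ zs ≡ a
  split = proj₁ cut
  zs-count : count M zs ≡ suc j
  zs-count = proj₁ (proj₂ cut)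
  zs' = proj₁ (proj₂ (proj₂ cut))
  zs-head : zs ≡ M ∷ zs'
  zs-head = proj₂ (proj₂ (proj₂ cut))
  a≤ : All (_≤ M) (xs ++ zs)
  a≤ = subst (All (_≤ M)) (sym split) (All≤maxOf a)
  xs≤ = All≤-suc xs (++⁻ˡ xs a≤)
  zs≤ = All≤-suc zs (++⁻ʳ xs a≤)
  M+1∉zs = suc∉ M zs (++⁻ʳ xs a≤)
  no-M+1 : count (suc M) (xs ++ zs) ≡ 0
  no-M+1 = ∉⇒count≡0 (suc M) (xs ++ zs) (suc∉ M (xs ++ zs) a≤)
  -- as j + 1 < count M a, an M is left of the cut
  M∈xs : M ∈ᵇ xs ≡ true
  M∈xs = count>0⇒∈ M xs (+-cancelʳ-< (suc j) 0 (count M xs)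
           (subst (suc j <_) (trans (cong (count M) (sym split)) (trans (count-++ M xs zs) (cong (count M xs +_) zs-count))) j<m))
  fits : fitsBefore (suc M) zs ≡ true
  fits rewrite zs-head = ≤⇒≤ᵇ-true (≤-refl {suc M})
  leftmost : leftmostOK (suc M) xs zs ≡ true
  leftmost rewrite suc∉ M xs (++⁻ˡ xs a≤) | M∈xs | zs-head | ∈-here M zs' = refl

childMaxCopy : ∀ a → T (isL a) → a ≢ [] → ∀ j → count (maxOf a) a ≤ suc j → j < wordLabel a →
               ChildOK a j (plug (maxOf a) (cutAt (maxOf a ∸ 1) (suc j ∸ count (maxOf a) a) a))
childMaxCopy a valid a≢[] j m≤ j<label = record
  { cvalid = insert-valid M xs zs xs≤ zs≤ M∉zs (fitsBefore-pred M zs (CutHead⇒EmptyOrHead (M ∸ 1) t zs zs-head))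
                          (leftmostOK-repeat M xs zs M∈xs) (subst (λ l → T (isL l)) (sym split) valid)
  ; clen = trans (length-++-sucʳ xs M zs) (cong (λ l → suc (length l)) split)
  ; clab = trans (insert-label M xs zs xs≤ zs≤ M∉zs)
                 (cong suc (trans (cong₂ _+_ (cong (count M) split) zs-count) (m+[n∸m]≡n m≤)))
  ; cparent = trans (insert-parent M xs zs xs≤ zs≤ M∉zs) split
  }
  where
  M = maxOf a
  m = count M a
  t = suc j ∸ m
  t≤after : t ≤ countAfterLast M (M ∸ 1) a
  t≤after = ≤-trans (∸-monoˡ-≤ m j<label) (≤-reflexive (m+n∸m≡n m _))
  xs = proj₁ (cutAt (M ∸ 1) t a)
  zs = proj₂ (cutAt (M ∸ 1) t a)
  cut = cutAt-spec (M ∸ 1) t a (≤-trans t≤after (countAfterLast≤count M (M ∸ 1) a))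
  split : xs ++ zs ≡ a
  split = proj₁ cut
  zs-count : count (M ∸ 1) zs ≡ t
  zs-count = proj₁ (proj₂ cut)
  zs-head = proj₂ (proj₂ cut)
  M∉zs : M ∈ᵇ zs ≡ false
  M∉zs = max∉cut M a xs zs t split zs-count zs-head t≤after
  a≤ : All (_≤ M) (xs ++ zs)
  a≤ = subst (All (_≤ M)) (sym split) (All≤maxOf a)
  xs≤ = ++⁻ˡ xs a≤
  zs≤ = ++⁻ʳ xs a≤
  M∈xs : M ∈ᵇ xs ≡ true
  M∈xs with M ∈ᵇ xs in M∈?
  ... | true = refl
  ... | false = ⊥-elim (true≢false (trans (sym (maxOf-∈ a a≢[]))
                  (trans (cong (M ∈ᵇ_) (sym split)) (trans (∈-++ M xs zs) (cong₂ _∨_ M∈? M∉zs)))))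

childSpec : ∀ a → T (isL a) → a ≢ [] → ∀ j → j < wordLabel a → ChildOK a j (wordChild a j)
childSpec a valid a≢[] j j<label with suc j <ᵇ count (maxOf a) a in j<m?
... | true = childNewMax a valid j (<ᵇ⇒< (suc j) _ (≡true⇒T j<m?))
... | false = childMaxCopy a valid a≢[] j (≮⇒≥ (λ lt → true≢false (trans (sym (T⇒≡true (<⇒<ᵇ lt))) j<m?))) j<label

record IsChild (a b : List ℕ) : Set where
  field
    index< : wordLabel b ∸ 2 < wordLabel a
    is-child : wordChild a (wordLabel b ∸ 2) ≡ b

parentOfMaxCopy : ∀ M xs zs → All (_≤ M) xs → All (_≤ M) zs → M ∈ᵇ zs ≡ false →
                  fitsBefore M zs ≡ true → M ∈ᵇ xs ≡ true → IsChild (xs ++ zs) (xs ++ M ∷ zs)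
parentOfMaxCopy M xs zs xs≤ zs≤ M∉zs fits M∈xs = record
  { index< = subst (j <_) (sym a-label)
               (≤-trans (≤-reflexive j+1) (+-monoʳ-≤ m (count≤countAfterLast M (M ∸ 1) xs zs M∈xs M∉zs)))
  ; is-child = begin
      childCase (maxOf a) a j (suc j <ᵇ count (maxOf a) a) ≡⟨ cong (λ v → childCase v a j (suc j <ᵇ count v a)) a-max ⟩
      childCase M a j (suc j <ᵇ m)                         ≡⟨ cong (childCase M a j) (¬T⇒≡false <ᵇ-false) ⟩
      plug M (cutAt (M ∸ 1) (suc j ∸ m) a)                 ≡⟨ cong (λ k → plug M (cutAt (M ∸ 1) k a)) t≡ ⟩
      plug M (cutAt (M ∸ 1) t a)                           ≡⟨ cong (plug M) (cut-back (M ∸ 1) xs zs shape) ⟩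
      xs ++ M ∷ zs                                         ∎
  }
  where
  open ≡-Reasoning
  a = xs ++ zs
  m = count M a
  t = count (M ∸ 1) zs
  M∈a = ∈-++ˡ M xs zs M∈xs
  a-max : maxOf a ≡ M
  a-max = maxOf-attained a (++⁺ xs≤ zs≤) M∈a
  m>0 : 0 < m
  m>0 = ∈⇒count>0 M a M∈a
  label : wordLabel (xs ++ M ∷ zs) ≡ suc m + t
  label = insert-label M xs zs xs≤ zs≤ M∉zs
  a-label : wordLabel a ≡ m + countAfterLast M (M ∸ 1) a
  a-label rewrite a-max = refl
  j = wordLabel (xs ++ M ∷ zs) ∸ 2
  j+1 : suc j ≡ m + t
  j+1 rewrite label with m | m>0
  ... | suc _ | _ = refl
  t≡ : suc j ∸ m ≡ t
  t≡ = trans (cong (_∸ m) j+1) (m+n∸m≡n m t)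
  shape = tailShape M zs fits zs≤ M∉zs
  <ᵇ-false : ¬ T (suc j <ᵇ m)
  <ᵇ-false lt = <⇒≱ (<ᵇ⇒< (suc j) m lt) (≤-trans (m≤m+n m t) (≤-reflexive (sym j+1)))

-- A word b = xs ++ M zs whose maximum M occurs only once is a child of the
-- first kind of xs ++ zs (M cannot be 0, as b has at least two entries).
parentOfNewMax : ∀ M xs zs → All (_≤ M) xs → All (_≤ M) zs → M ∈ᵇ zs ≡ false →
                 fitsBefore M zs ≡ true → leftmostOK M xs zs ≡ true → M ∈ᵇ xs ≡ false →
                 2 ≤ length (xs ++ M ∷ zs) → IsChild (xs ++ zs) (xs ++ M ∷ zs)
parentOfNewMax zero xs zs xs≤ zs≤ M∉zs _ _ M∉xs 2≤length
  rewrite All≤0-empty xs xs≤ M∉xs | All≤0-empty zs zs≤ M∉zs with 2≤length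
... | s≤s ()
parentOfNewMax (suc M) xs zs xs≤ zs≤ M+1∉zs fits leftmost M+1∉xs _ = record
  { index< = subst (j <_) (sym a-label) (≤-trans (≤-reflexive j+1) (≤-trans (<⇒≤ k<count) (m≤m+n _ _)))
  ; is-child = begin
      childCase (maxOf a) a j (suc j <ᵇ count (maxOf a) a) ≡⟨ cong (λ v → childCase v a j (suc j <ᵇ count v a)) a-max ⟩
      childCase M a j (suc j <ᵇ count M a)                 ≡⟨ cong (childCase M a j) (T⇒≡true (<⇒<ᵇ j<count)) ⟩
      plug (suc M) (cutAt M (suc j) a)                     ≡⟨ cong (λ i → plug (suc M) (cutAt M i a)) j+1 ⟩
      plug (suc M) (cutAt M k a)                           ≡⟨ cong (plug (suc M)) (cut-back M xs zs shape) ⟩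
      xs ++ suc M ∷ zs                                     ∎
  }
  where
  open ≡-Reasoning
  a = xs ++ zs
  k = count M zs
  -- the new maximum is a leftmost occurrence, so M occurs on both of its sides
  M∈xs×M∈zs : (M ∈ᵇ xs) ≡ true × (M ∈ᵇ zs) ≡ true
  M∈xs×M∈zs = ∧-true⁻ (trans (cong (λ b → if b then true else ((M ∈ᵇ xs) ∧ (M ∈ᵇ zs))) (sym M+1∉xs)) leftmost)
  M+1∉a : suc M ∈ᵇ a ≡ false
  M+1∉a = trans (∈-++ (suc M) xs zs) (cong₂ _∨_ M+1∉xs M+1∉zs)
  a-max : maxOf a ≡ M
  a-max = maxOf-attained a (All≤-pred M a (++⁺ xs≤ zs≤) M+1∉a) (∈-++ˡ M xs zs (proj₁ M∈xs×M∈zs))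
  k>0 : 0 < k
  k>0 = ∈⇒count>0 M zs (proj₂ M∈xs×M∈zs)
  k<count : k < count M a
  k<count = subst (k <_) (sym (count-++ M xs zs)) (+-monoˡ-≤ k (∈⇒count>0 M xs (proj₁ M∈xs×M∈zs)))
  label : wordLabel (xs ++ suc M ∷ zs) ≡ suc k
  label = trans (insert-label (suc M) xs zs xs≤ zs≤ M+1∉zs) (cong (λ c → suc c + k) (∉⇒count≡0 (suc M) a M+1∉a))
  a-label : wordLabel a ≡ count M a + countAfterLast M (M ∸ 1) a
  a-label rewrite a-max = refl
  j = wordLabel (xs ++ suc M ∷ zs) ∸ 2
  j+1 : suc j ≡ k
  j+1 rewrite label with k | k>0
  ... | suc _ | _ = refl
  j<count : suc j < count M a
  j<count = subst (_< count M a) (sym j+1) k<count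
  shape = tailShape (suc M) zs fits zs≤ M+1∉zs

record ParentOK (b : List ℕ) : Set where
  field
    pvalid : T (isL (wordParent b))
    plen : suc (length (wordParent b)) ≡ length b
    pchild : IsChild (wordParent b) b

parentCore : ∀ M xs zs → All (_≤ M) xs → All (_≤ M) zs → M ∈ᵇ zs ≡ false →
             T (isL (xs ++ M ∷ zs)) → 2 ≤ length (xs ++ M ∷ zs) → ParentOK (xs ++ M ∷ zs)
parentCore M xs zs xs≤ zs≤ M∉zs valid 2≤length = record
  { pvalid = subst (λ l → T (isL l)) (sym parent≡) (proj₂ conditions)
  ; plen = trans (cong (λ l → suc (length l)) parent≡) (sym (length-++-sucʳ xs M zs))
  ; pchild = subst (λ l → IsChild l (xs ++ M ∷ zs)) (sym parent≡) child
  }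
  where
  parent≡ = insert-parent M xs zs xs≤ zs≤ M∉zs
  conditions = insert-valid⁻ M xs zs xs≤ zs≤ M∉zs valid
  fits = proj₁ (proj₁ conditions)
  leftmost = proj₂ (proj₁ conditions)
  child : IsChild (xs ++ zs) (xs ++ M ∷ zs)
  child with M ∈ᵇ xs in M∈xs?
  ... | true = parentOfMaxCopy M xs zs xs≤ zs≤ M∉zs fits M∈xs?
  ... | false = parentOfNewMax M xs zs xs≤ zs≤ M∉zs fits leftmost M∈xs? 2≤length

-- Every word of length ≥ 2 is a child of its parent: cut it before the last
-- occurrence of its maximum.
parentSpec : ∀ b → T (isL b) → 2 ≤ length b → ParentOK b
parentSpec b valid 2≤length = subst ParentOK (sym b≡) (parentCore M xs zs xs≤ zs≤ M∉zs
  (subst (λ l → T (isL l)) b≡ valid) (subst (λ l → 2 ≤ length l) b≡ 2≤length))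
  where
  M = maxOf b
  b≢[] : b ≢ []
  b≢[] b≡[] with subst (λ l → 2 ≤ length l) b≡[] 2≤length
  ... | ()
  cut = cutAt-spec M 1 b (∈⇒count>0 M b (maxOf-∈ b b≢[]))
  xs = proj₁ (cutAt M 1 b)
  zs = proj₁ (proj₂ (proj₂ cut))
  zs-head : proj₂ (cutAt M 1 b) ≡ M ∷ zs
  zs-head = proj₂ (proj₂ (proj₂ cut))
  M∉zs : M ∈ᵇ zs ≡ false
  M∉zs = count≡0⇒∉ M zs (suc-injective (trans (sym (trans (cong (count M) zs-head) (count-here M zs))) (proj₁ (proj₂ cut))))
  b≡ : b ≡ xs ++ M ∷ zs
  b≡ = trans (sym (proj₁ cut)) (cong (xs ++_) zs-head)
  b≤ : All (_≤ M) (xs ++ M ∷ zs)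
  b≤ = subst (All (_≤ M)) b≡ (All≤maxOf b)
  xs≤ = ++⁻ˡ xs b≤
  zs≤ : All (_≤ M) zs
  zs≤ with ++⁻ʳ xs b≤
  ... | _ ∷ zs≤ = zs≤

WordList : ℕ → Set
WordList n = Sized isL (suc n)

wordLabelOf : ∀ {m} → Sized isL m → ℕ
wordLabelOf x = wordLabel (list x)

nonempty : ∀ {n} (a : List ℕ) → length a ≡ suc n → a ≢ []
nonempty [] ()
nonempty (y ∷ ys) _ ()

wordSplit : ∀ n → WordList (suc n) ↔ Σ (WordList n) (λ x → Fin (wordLabelOf x))
wordSplit n = mk↔ₛ′ parent child parent-child child-parent
  where
  atLeast2 : ∀ b → length b ≡ suc (suc n) → 2 ≤ length b
  atLeast2 b l = subst (2 ≤_) (sym l) (s≤s (s≤s z≤n))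
  parent : WordList (suc n) → Σ (WordList n) (λ x → Fin (wordLabelOf x))
  parent (sized b v l) =
    sized (wordParent b) (ParentOK.pvalid P) (suc-injective (trans (ParentOK.plen P) l))
    , fromℕ< (IsChild.index< (ParentOK.pchild P))
    where P = parentSpec b v (atLeast2 b l)
  child : Σ (WordList n) (λ x → Fin (wordLabelOf x)) → WordList (suc n)
  child (sized a v l , j) = sized (wordChild a (toℕ j)) (ChildOK.cvalid C) (trans (ChildOK.clen C) (cong suc l))
    where C = childSpec a v (nonempty a l) (toℕ j) (toℕ<n j)
  parent-child : ∀ y → parent (child y) ≡ y
  parent-child (sized a v l , j) =
    Σ-Fin-≡ (Sized-≡ (ChildOK.cparent C)) (trans (toℕ-fromℕ< _) (cong (_∸ 2) (ChildOK.clab C)))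
    where C = childSpec a v (nonempty a l) (toℕ j) (toℕ<n j)
  child-parent : ∀ x → child (parent x) ≡ x
  child-parent (sized b v l) =
    Sized-≡ (trans (cong (wordChild (wordParent b)) (toℕ-fromℕ< _)) (IsChild.is-child (ParentOK.pchild P)))
    where P = parentSpec b v (atLeast2 b l)

wordTree : GeneratingTree
wordTree = record
  { Node = WordList
  ; label = wordLabelOf
  ; split = wordSplit
  ; label-child = λ { n (sized a v l) i → ChildOK.clab (childSpec a v (nonempty a l) (toℕ i) (toℕ<n i)) }
  }

norths : List Step → ℕ
norths [] = 0
norths (N ∷ w) = suc (norths w)
norths (E ∷ w) = norths w

Paths : ℕ → ℕ → Set
Paths n k = Sized (λ w → norths w ≡ᵇ k) n

-- Paths are counted by binomial coefficients (Pascal's rule on the first step).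
binomial : ∀ n k → Paths n k ↔ Fin (n C k)
binomial zero zero = mk↔ₛ′ (λ _ → Fin.zero) (λ _ → sized [] _ refl) (λ { Fin.zero → refl ; (Fin.suc ()) })
  (λ { (sized [] _ refl) → refl })
binomial zero (suc k) = mk↔ₛ′ (λ { (sized [] () refl) }) (λ ()) (λ ()) (λ { (sized [] () refl) })
binomial (suc n) zero = ↔-trans dropE (binomial n zero)
  where
  dropE : Paths (suc n) 0 ↔ Paths n 0
  dropE = mk↔ₛ′ (λ { (sized (E ∷ w) p l) → sized w p (suc-injective l) ; (sized (N ∷ w) () l) })
                (λ { (sized w p l) → sized (E ∷ w) p (cong suc l) })
                (λ _ → Sized-≡ refl)
                (λ { (sized (E ∷ w) p l) → Sized-≡ refl ; (sized (N ∷ w) () l) })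
binomial (suc n) (suc k) = begin
  Paths (suc n) (suc k)              ↔⟨ firstStep ⟩
  (Paths n k ⊎ Paths n (suc k))      ↔⟨ ⊎-cong (binomial n k) (binomial n (suc k)) ⟩
  (Fin (n C k) ⊎ Fin (n C suc k))    ↔⟨ +↔⊎ ⟨
  Fin (n C k + n C suc k)            ↔⟨ Fin-cong (nCk+nC[k+1]≡[n+1]C[k+1] n k) ⟩
  Fin (suc n C suc k)                ∎
  where
  open EquationalReasoning
  firstStep : Paths (suc n) (suc k) ↔ (Paths n k ⊎ Paths n (suc k))
  firstStep = mk↔ₛ′
    (λ { (sized (N ∷ w) p l) → inj₁ (sized w p (suc-injective l))
       ; (sized (E ∷ w) p l) → inj₂ (sized w p (suc-injective l)) })
    (λ { (inj₁ (sized w p l)) → sized (N ∷ w) p (cong suc l)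
       ; (inj₂ (sized w p l)) → sized (E ∷ w) p (cong suc l) })
    (λ { (inj₁ _) → cong inj₁ (Sized-≡ refl) ; (inj₂ _) → cong inj₂ (Sized-≡ refl) })
    (λ { (sized (N ∷ w) p l) → Sized-≡ refl ; (sized (E ∷ w) p l) → Sized-≡ refl })

dips : ℕ → List Step → Bool
dips h [] = false
dips h (N ∷ w) = dips (suc h) w
dips (suc h) (E ∷ w) = dips h w
dips zero (E ∷ w) = true

mirror : List Step → List Step
mirror [] = []
mirror (N ∷ w) = E ∷ mirror w
mirror (E ∷ w) = N ∷ mirror w

reflect : ℕ → List Step → List Step
reflect h [] = []
reflect h (N ∷ w) = N ∷ reflect (suc h) w
reflect (suc h) (E ∷ w) = E ∷ reflect h w
reflect zero (E ∷ w) = E ∷ mirror w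

mirror-involutive : ∀ w → mirror (mirror w) ≡ w
mirror-involutive [] = refl
mirror-involutive (N ∷ w) = cong (N ∷_) (mirror-involutive w)
mirror-involutive (E ∷ w) = cong (E ∷_) (mirror-involutive w)

norths-mirror : ∀ w → norths (mirror w) + norths w ≡ length w
norths-mirror [] = refl
norths-mirror (N ∷ w) = trans (+-suc (norths (mirror w)) (norths w)) (cong suc (norths-mirror w))
norths-mirror (E ∷ w) = cong suc (norths-mirror w)

length-mirror : ∀ w → length (mirror w) ≡ length w
length-mirror [] = refl
length-mirror (N ∷ w) = cong suc (length-mirror w)
length-mirror (E ∷ w) = cong suc (length-mirror w)

reflect-involutive : ∀ h w → reflect h (reflect h w) ≡ w
reflect-involutive h [] = refl
reflect-involutive h (N ∷ w) = cong (N ∷_) (reflect-involutive (suc h) w)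
reflect-involutive (suc h) (E ∷ w) = cong (E ∷_) (reflect-involutive h w)
reflect-involutive zero (E ∷ w) = cong (E ∷_) (mirror-involutive w)

length-reflect : ∀ h w → length (reflect h w) ≡ length w
length-reflect h [] = refl
length-reflect h (N ∷ w) = cong suc (length-reflect (suc h) w)
length-reflect (suc h) (E ∷ w) = cong suc (length-reflect h w)
length-reflect zero (E ∷ w) = cong suc (length-mirror w)

dips-reflect : ∀ h w → dips h (reflect h w) ≡ dips h w
dips-reflect h [] = refl
dips-reflect h (N ∷ w) = dips-reflect (suc h) w
dips-reflect (suc h) (E ∷ w) = dips-reflect h w
dips-reflect zero (E ∷ w) = refl

norths-reflect : ∀ h w → dips h w ≡ true → norths (reflect h w) + norths w + suc h ≡ length w
norths-reflect h [] ()
norths-reflect h (N ∷ w) c = begin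
    suc (norths (reflect (suc h) w)) + suc (norths w) + suc h
  ≡⟨ cong (λ x → suc (x + suc h)) (+-suc (norths (reflect (suc h) w)) (norths w)) ⟩
    suc (suc (norths (reflect (suc h) w) + norths w) + suc h)
  ≡⟨ cong suc (sym (+-suc (norths (reflect (suc h) w) + norths w) (suc h))) ⟩
    suc (norths (reflect (suc h) w) + norths w + suc (suc h))
  ≡⟨ cong suc (norths-reflect (suc h) w c) ⟩
    suc (length w) ∎
  where open ≡-Reasoning
norths-reflect (suc h) (E ∷ w) c = trans (+-suc _ (suc h)) (cong suc (norths-reflect h w c))
norths-reflect zero (E ∷ w) c = trans (+-suc _ 0) (cong suc (trans (+-identityʳ _) (norths-mirror w)))

length-nondipping : ∀ h w → dips h w ≡ false → length w ≤ norths w + norths w + h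
length-nondipping h [] c = z≤n
length-nondipping h (N ∷ w) c = s≤s (≤-trans (length-nondipping (suc h) w c) (≤-reflexive eq))
  where
  eq : norths w + norths w + suc h ≡ norths w + suc (norths w) + h
  eq = trans (+-suc (norths w + norths w) h) (cong (_+ h) (sym (+-suc (norths w) (norths w))))
length-nondipping (suc h) (E ∷ w) c = ≤-trans (s≤s (length-nondipping h w c)) (≤-reflexive (sym (+-suc _ h)))
length-nondipping zero (E ∷ w) ()

shift-north : ∀ h w → norths w + suc (norths w) + h ≡ norths w + norths w + suc h
shift-north h w = trans (cong (_+ h) (+-suc (norths w) (norths w))) (sym (+-suc (norths w + norths w) h))

dyck⇒balanced : ∀ h w → dyckFrom h w ≡ true → norths w + norths w + h ≡ length w
dyck⇒balanced zero [] d = refl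
dyck⇒balanced (suc h) [] ()
dyck⇒balanced h (N ∷ w) d = cong suc (trans (shift-north h w) (dyck⇒balanced (suc h) w d))
dyck⇒balanced (suc h) (E ∷ w) d = trans (+-suc _ h) (cong suc (dyck⇒balanced h w d))
dyck⇒balanced zero (E ∷ w) ()

balanced⇒dyck : ∀ h w → norths w + norths w + h ≡ length w → dyckFrom h w ≡ not (dips h w)
balanced⇒dyck zero [] b = refl
balanced⇒dyck (suc h) [] ()
balanced⇒dyck h (N ∷ w) b = balanced⇒dyck (suc h) w (trans (sym (shift-north h w)) (suc-injective b))
balanced⇒dyck (suc h) (E ∷ w) b = balanced⇒dyck h w (suc-injective (trans (sym (+-suc _ h)) b))
balanced⇒dyck zero (E ∷ w) b = refl

dyck-characterization : ∀ m w → length w ≡ 2 * m → dyckFrom 0 w ≡ not (dips 0 w) ∧ (norths w ≡ᵇ m)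
dyck-characterization m w l with norths w ≟ m
... | yes refl = begin
    dyckFrom 0 w                           ≡⟨ balanced⇒dyck 0 w balanced ⟩
    not (dips 0 w)                         ≡⟨ ∧-identityʳ _ ⟨
    not (dips 0 w) ∧ true                  ≡⟨ cong (not (dips 0 w) ∧_) (≡ᵇ-refl (norths w)) ⟨
    not (dips 0 w) ∧ (norths w ≡ᵇ norths w) ∎
  where
  open ≡-Reasoning
  balanced : norths w + norths w + 0 ≡ length w
  balanced = trans (+-identityʳ _) (trans (cong (norths w +_) (sym (+-identityʳ _))) (sym l))
... | no norths≢m = trans notDyck (sym (trans (cong (not (dips 0 w) ∧_) (≢⇒≡ᵇ-false _ _ norths≢m)) (∧-zeroʳ _)))
  where
  notDyck : dyckFrom 0 w ≡ false
  notDyck with dyckFrom 0 w in d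
  ... | false = refl
  ... | true = ⊥-elim (norths≢m (*-cancelˡ-≡ (norths w) m 2
                 (trans (cong (norths w +_) (+-identityʳ _))
                   (trans (sym (+-identityʳ _)) (trans (dyck⇒balanced 0 w d) l)))))

reflected-norths : ∀ a b m → a + b + 1 ≡ 2 * suc m → a + b ≡ suc m + m
reflected-norths a b m e = suc-injective (trans (sym (+1 a b)) (trans e (double m)))
  where
  +1 : ∀ a b → a + b + 1 ≡ suc (a + b)
  +1 = solve-∀
  double : ∀ m → 2 * suc m ≡ suc (suc m + m)
  double = solve-∀

-- Reflection principle: reflecting everything after the first dip is a
-- bijection between the dipping paths with m+1 north steps and all paths with
-- m north steps, both of length 2(m+1).
reflection : ∀ m → Sized (λ w → dips 0 w ∧ (norths w ≡ᵇ suc m)) (2 * suc m) ↔ Paths (2 * suc m) m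
reflection m = mk↔ₛ′ forward backward
  (λ x → Sized-≡ (reflect-involutive 0 (list x))) (λ x → Sized-≡ (reflect-involutive 0 (list x)))
  where
  forward : Sized (λ w → dips 0 w ∧ (norths w ≡ᵇ suc m)) (2 * suc m) → Paths (2 * suc m) m
  forward (sized w p l) = sized (reflect 0 w) (≡⇒≡ᵇ _ m northCount) (trans (length-reflect 0 w) l)
    where
    dip = Equivalence.to T-≡ (proj₁ (Equivalence.to T-∧ p))
    north = ≡ᵇ⇒≡ _ _ (proj₂ (Equivalence.to T-∧ p))
    northCount : norths (reflect 0 w) ≡ m
    northCount = +-cancelʳ-≡ (suc m) _ m (trans
      (reflected-norths (norths (reflect 0 w)) (suc m) m (trans (cong (λ k → norths (reflect 0 w) + k + 1) (sym north))
                                      (trans (norths-reflect 0 w dip) l)))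
      (+-comm (suc m) m))
  backward : Paths (2 * suc m) m → Sized (λ w → dips 0 w ∧ (norths w ≡ᵇ suc m)) (2 * suc m)
  backward (sized w p l) = sized (reflect 0 w)
    (Equivalence.from T-∧ (Equivalence.from T-≡ (trans (dips-reflect 0 w) dip) , ≡⇒≡ᵇ _ (suc m) northCount))
    (trans (length-reflect 0 w) l)
    where
    north = ≡ᵇ⇒≡ _ _ p
    dip : dips 0 w ≡ true
    dip with dips 0 w in e
    ... | true = refl
    ... | false = ⊥-elim (<⇒≱ tooShort (subst (λ k → length w ≤ k + k + 0) north (length-nondipping 0 w e)))
      where
      tooShort : m + m + 0 < length w
      tooShort rewrite l | +-identityʳ (m + m) | +-identityʳ m | +-suc m m = s≤s (n≤1+n _)
    northCount : norths (reflect 0 w) ≡ suc m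
    northCount = +-cancelʳ-≡ m _ (suc m) (reflected-norths (norths (reflect 0 w)) m m
      (trans (cong (λ k → norths (reflect 0 w) + k + 1) (sym north)) (trans (norths-reflect 0 w dip) l)))

absorption : ∀ n k → suc k * (suc n C suc k) ≡ suc n * (n C k)
absorption zero zero = refl
absorption zero (suc k) = *-zeroʳ (suc (suc k))
absorption (suc n) zero = trans (+-identityʳ _) (trans (nC1≡n (suc (suc n))) (sym (*-identityʳ _)))
absorption (suc n) (suc k) = begin
    suc (suc k) * (suc (suc n) C suc (suc k))  ≡⟨ cong (suc (suc k) *_) (nCk+nC[k+1]≡[n+1]C[k+1] (suc n) (suc k)) ⟨
    suc (suc k) * (P + Q)                      ≡⟨ expand k P Q ⟩
    (suc k * P + P) + suc (suc k) * Q          ≡⟨ cong₂ (λ x y → (x + P) + y) (absorption n k) (absorption n (suc k)) ⟩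
    (suc n * A + P) + suc n * B                ≡⟨ collect n A B P ⟩
    suc n * (A + B) + P                        ≡⟨ cong (λ x → suc n * x + P) (nCk+nC[k+1]≡[n+1]C[k+1] n k) ⟩
    suc n * P + P                              ≡⟨ +-comm (suc n * P) P ⟩
    suc (suc n) * P                            ∎
  where
  open ≡-Reasoning
  A = n C k
  B = n C suc k
  P = suc n C suc k
  Q = suc n C suc (suc k)
  expand : ∀ k P Q → suc (suc k) * (P + Q) ≡ (suc k * P + P) + suc (suc k) * Q
  expand = solve-∀
  collect : ∀ n A B P → (suc n * A + P) + suc n * B ≡ suc n * (A + B) + P
  collect = solve-∀

central-vs-adjacent : ∀ m' → let m = suc m' in m * ((2 * m) C m) ≡ suc m * ((2 * m) C m')
central-vs-adjacent m' = +-cancelˡ-≡ (m * Y) (m * X) (suc m * Y) (begin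
    m * Y + m * X        ≡⟨ *-distribˡ-+ m Y X ⟨
    m * (Y + X)          ≡⟨ cong (m *_) (nCk+nC[k+1]≡[n+1]C[k+1] (2 * m) m') ⟩
    m * (suc n C m)      ≡⟨ absorption n m' ⟩
    suc n * Y            ≡⟨ odd m Y ⟩
    m * Y + suc m * Y    ∎)
  where
  open ≡-Reasoning
  m = suc m'
  n = 2 * m
  X = n C m
  Y = n C m'
  odd : ∀ m Y → suc (2 * m) * Y ≡ m * Y + suc m * Y
  odd = solve-∀

-- Cat_m = C(2m, m) - C(2m, m-1) for m ≥ 1, as (m+1) divides the difference.
central-binomial-split : ∀ m' → let m = suc m' in (2 * m) C m ≡ (2 * m) C m' + catalan m
central-binomial-split m' = trans (sym (m+[n∸m]≡n Y≤X)) (cong (Y +_) (sym catalan≡))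
  where
  m = suc m'
  X = (2 * m) C m
  Y = (2 * m) C m'
  mX≡[m+1]Y = central-vs-adjacent m'
  Y≤X : Y ≤ X
  Y≤X = *-cancelˡ-≤ (suc m) (≤-trans (≤-reflexive (sym mX≡[m+1]Y)) (*-monoˡ-≤ X (n≤1+n m)))
  times : (X ∸ Y) * suc m ≡ X
  times = begin
      (X ∸ Y) * suc m         ≡⟨ *-distribʳ-∸ (suc m) X Y ⟩
      X * suc m ∸ Y * suc m   ≡⟨ cong₂ _∸_ (*-suc X m) (trans (*-comm Y (suc m)) (sym mX≡[m+1]Y)) ⟩
      (X + X * m) ∸ m * X     ≡⟨ cong (λ z → (X + z) ∸ m * X) (*-comm X m) ⟩
      (X + m * X) ∸ m * X     ≡⟨ m+n∸n≡m X (m * X) ⟩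
      X                       ∎
    where open ≡-Reasoning
  catalan≡ : catalan m ≡ X ∸ Y
  catalan≡ = trans (cong (_/ suc m) (sym times)) (m*n/n≡m (X ∸ Y) (suc m))

dyckCount : ∀ m → DyckList m ↔ Fin (catalan m)
dyckCount zero = mk↔ₛ′ (λ _ → Fin.zero) (λ _ → sized [] _ refl) (λ { Fin.zero → refl ; (Fin.suc ()) })
  (λ { (sized [] _ refl) → refl })
dyckCount (suc m) = cancel-Fin ((2 * M) C m) (begin
  (Fin ((2 * M) C m) ⊎ DyckList M)                 ↔⟨ ⊎-cong (binomial (2 * M) m) ↔-refl ⟨
  (Paths (2 * M) m ⊎ DyckList M)                   ↔⟨ ⊎-cong (↔-sym (reflection m)) dyck↔staying ⟩
  (Sized Dipping (2 * M) ⊎ Sized Staying (2 * M))  ↔⟨ ⊎-comm _ _ ⟩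
  (Sized Staying (2 * M) ⊎ Sized Dipping (2 * M))  ↔⟨ partition (λ w → norths w ≡ᵇ M) (dips 0) (2 * M) ⟨
  Paths (2 * M) M                                  ↔⟨ binomial (2 * M) M ⟩
  Fin ((2 * M) C M)                                ↔⟨ Fin-cong (central-binomial-split m) ⟩
  Fin ((2 * M) C m + catalan M)                    ↔⟨ +↔⊎ ⟩
  (Fin ((2 * M) C m) ⊎ Fin (catalan M))            ∎)
  where
  open EquationalReasoning
  M = suc m
  dyck↔staying = Sized-cong (2 * M) (dyck-characterization M)
  Staying Dipping : List Step → Bool
  Staying w = not (dips 0 w) ∧ (norths w ≡ᵇ M)
  Dipping w = dips 0 w ∧ (norths w ≡ᵇ M)

rootIso : LabelIso wordTree dyckTree 0
rootIso = mk↔ₛ′ (λ _ → sized [] _ refl) (λ _ → sized (0 ∷ []) _ refl) toEmpty fromWord0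
        , λ x → cong wordLabelOf (fromWord0 x)
  where
  toEmpty : ∀ y → sized [] _ refl ≡ y
  toEmpty (sized [] _ refl) = refl
  fromWord0 : ∀ x → sized (0 ∷ []) _ refl ≡ x
  fromWord0 (sized (zero ∷ []) _ refl) = refl
  fromWord0 (sized (suc _ ∷ []) () _)

words↔dyck : ∀ n → L (suc n) ↔ D n
words↔dyck n = begin
  L (suc n)    ↔⟨ vec↔sized isL (suc n) ⟩
  WordList n   ↔⟨ proj₁ (treeIso wordTree dyckTree rootIso n) ⟩
  DyckList n   ↔⟨ vec↔sized (dyckFrom 0) (2 * n) ⟨
  D n          ∎
  where open EquationalReasoning

mainTheorem1 : (n : ℕ) → 1 ≤ n →
    (L n ⤖ D (n ∸ 1)) × (L n ⤖ Fin (catalan (n ∸ 1)))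
mainTheorem1 (suc n) _ = ↔⇒⤖ (words↔dyck n) , ↔⇒⤖ (begin
  L (suc n)           ↔⟨ words↔dyck n ⟩
  D n                 ↔⟨ vec↔sized (dyckFrom 0) (2 * n) ⟩
  DyckList n          ↔⟨ dyckCount n ⟩
  Fin (catalan n)     ∎)
  where open EquationalReasoning
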